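{- There are infinitely many (pairwise non-isomorphic) reflexible $4$-maniplexes $(G,(\rho_0,\rho_1,\rho_2,\rho_3))$ with $G\cong{\rm PSL}_2(q)$ for some prime power $q$ that belong to Class 1, i.e. such that $\langle\rho_1,\rho_2,\rho_3\rangle\cong G$ and $\langle\rho_0,\rho_1,\rho_2\rangle\cong G$.
   Context: A string representation of rank $n$ of a group $G$ is an $n$-tuple $(\rho_0,\ldots,\rho_{n-1})$ of pairwise distinct involutions generating $G$ with $\rho_i\rho_j=\rho_j\rho_i$ whenever $|i-j|>1$. A reflexible $n$-maniplex with automorphism group $G$ is identified with a pair $(G,(\rho_0,\ldots,\rho_{n-1}))$ where $(\rho_i)$ is a string representation of $G$; two such are isomorphic iff a group isomorphism maps the generators of one to those of the other in order. -}

module Defs where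

open import Level using (Level; 0ℓ; _⊔_)
open import Data.Nat using (ℕ; _≥_)
open import Data.Nat.Primality using (Prime)
open import Data.Fin using (Fin; zero; suc)
open import Data.List using (List; []; _∷_)
open import Data.Bool using (Bool; true; false)
open import Data.Product using (Σ; ∃; ∃-syntax; _×_; _,_)
open import Data.Sum using (_⊎_)
open import Relation.Nullary using (¬_)
open import Relation.Binary.PropositionalEquality using (_≡_; _≢_)
open import Function.Definitions using (Injective; Surjective)
open import Algebra.Bundles using (Group; CommutativeRing)
open import Algebra.Morphism.Structures using (module GroupMorphisms)

module _ {c ℓ} (G : Group c ℓ) where
  open Group G

  evalWord : ∀ {n} → (Fin n → Carrier) → List (Fin n × Bool) → Carrier
  evalWord g []                 = ε
  evalWord g ((i , false) ∷ w)  = g i ∙ evalWord g w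
  evalWord g ((i , true)  ∷ w)  = (g i ⁻¹) ∙ evalWord g w

  InGenerated : ∀ {n} → (Fin n → Carrier) → Carrier → Set ℓ
  InGenerated g x = ∃[ w ] evalWord g w ≈ x

  Generates : ∀ {n} → (Fin n → Carrier) → Set (c ⊔ ℓ)
  Generates g = ∀ x → InGenerated g x

  IsInvolution : Carrier → Set ℓ
  IsInvolution x = (¬ (x ≈ ε)) × (x ∙ x ≈ ε)

  Commute : Carrier → Carrier → Set ℓ
  Commute x y = x ∙ y ≈ y ∙ x

module _ {c ℓ} (G : Group c ℓ) where
  open Group G

  record IsStringRep4 (ρ : Fin 4 → Carrier) : Set (c ⊔ ℓ) where
    field
      involutions : ∀ i → IsInvolution G (ρ i)
      distinct    : ∀ i j → i ≢ j → ¬ (ρ i ≈ ρ j)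
      generating  : Generates G ρ
      comm02      : Commute G (ρ zero) (ρ (suc (suc zero)))
      comm03      : Commute G (ρ zero) (ρ (suc (suc (suc zero))))
      comm13      : Commute G (ρ (suc zero)) (ρ (suc (suc (suc zero))))

record Maniplex4 (c ℓ : Level) : Set (Level.suc (c ⊔ ℓ)) where
  field
    group     : Group c ℓ
    ρ         : Fin 4 → Group.Carrier group
    stringRep : IsStringRep4 group ρ

ManiplexIso : ∀ {c ℓ} → Maniplex4 c ℓ → Maniplex4 c ℓ → Set (c ⊔ ℓ)
ManiplexIso M M' =
  ∃[ f ] (IsGroupIsomorphism f × (∀ i → f (M.ρ i) ≈' M'.ρ i))
  where
    module M  = Maniplex4 M
    module M' = Maniplex4 M'
    open GroupMorphisms (Group.rawGroup M.group) (Group.rawGroup M'.group)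
    _≈'_ = Group._≈_ M'.group

Class1 : ∀ {c ℓ} → Maniplex4 c ℓ → Set (c ⊔ ℓ)
Class1 M =
  Generates group (λ i → ρ (suc i)) × Generates group (λ i → ρ (Data.Fin.inject₁ i))
  where open Maniplex4 M

module _ {c ℓ} (F : CommutativeRing c ℓ) where
  open CommutativeRing F

  record IsField : Set (c ⊔ ℓ) where
    field
      0≉1     : ¬ (0# ≈ 1#)
      inverse : ∀ x → ¬ (x ≈ 0#) → ∃[ y ] (x * y ≈ 1#)

  HasOrder : ℕ → Set (c ⊔ ℓ)
  HasOrder q = Σ (Fin q → Carrier) λ e → Injective _≡_ _≈_ e × Surjective _≡_ _≈_ e

  record Mat2 : Set c where
    constructor mat
    field a b c' d : Carrier

  _≈ₘ_ : Mat2 → Mat2 → Set ℓ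
  mat a b c' d ≈ₘ mat a' b' c'' d' = (a ≈ a') × (b ≈ b') × (c' ≈ c'') × (d ≈ d')

  _·_ : Mat2 → Mat2 → Mat2
  mat a b c' d · mat a' b' c'' d' =
    mat (a * a' + b * c'') (a * b' + b * d') (c' * a' + d * c'') (c' * b' + d * d')

  det : Mat2 → Carrier
  det (mat a b c' d) = a * d - b * c'

  I₂ : Mat2
  I₂ = mat 1# 0# 0# 1#

  -I₂ : Mat2
  -I₂ = mat (- 1#) 0# 0# (- 1#)

  SL₂ : Set (c ⊔ ℓ)
  SL₂ = Σ Mat2 λ M → det M ≈ 1#

-- G ≅ PSL₂(F) = SL₂(F)/{±I}: expressed (no quotient types) as a surjective
-- homomorphism SL₂(F) → G, well defined on ≈-classes, with kernel exactly {I, -I}.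
module _ {c ℓ c' ℓ'} (G : Group c ℓ) (F : CommutativeRing c' ℓ') where
  open Group G
  private
    _≈F_ = _≈ₘ_ F

  IsPSL₂Iso : (SL₂ F → Carrier) → Set (c ⊔ ℓ ⊔ c' ⊔ ℓ')
  IsPSL₂Iso φ =
      (∀ M N → Data.Product.proj₁ M ≈F Data.Product.proj₁ N → φ M ≈ φ N)
    × (∀ M N P → Data.Product.proj₁ P ≈F _·_ F (Data.Product.proj₁ M) (Data.Product.proj₁ N)
               → φ P ≈ φ M ∙ φ N)
    × (∀ g → ∃[ M ] φ M ≈ g)
    × (∀ M → φ M ≈ ε → (Data.Product.proj₁ M ≈F I₂ F) ⊎ (Data.Product.proj₁ M ≈F -I₂ F))
    × (∀ M → (Data.Product.proj₁ M ≈F I₂ F) ⊎ (Data.Product.proj₁ M ≈F -I₂ F) → φ M ≈ ε)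

  IsoToPSL₂ : Set (c ⊔ ℓ ⊔ c' ⊔ ℓ')
  IsoToPSL₂ = ∃[ φ ] IsPSL₂Iso φ

IsPSL₂OfPrimePower : Group 0ℓ 0ℓ → Set₁
IsPSL₂OfPrimePower G =
  Σ (CommutativeRing 0ℓ 0ℓ) λ F →
  Σ ℕ λ q → Σ ℕ λ p → Σ ℕ λ k →
    Prime p × k ≥ 1 × q ≡ p Data.Nat.^ k
    × IsField F × HasOrder F q × IsoToPSL₂ G F

{-# OPTIONS --safe #-}

-- Let p be an odd prime dividing N⁴ + 1, so that ζ = N is a primitive 8th root of unity mod p and
-- ι = ζ² is a square root of -1. In SL₂(𝔽ₚ) the trace-zero matrices
--   ρ₀ = (1 1+ι ; -1+ι -1),  ρ₁ = (ι 0 ; 0 -ι),  ρ₂ = (ι -1+ι ; 0 -ι),  ρ₃ = (0 ζ³ ; ζ 0)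
-- square to -I, and ρ₀ anticommutes with ρ₂ and ρ₃, ρ₁ with ρ₃; so they give a string representation
-- of PSL₂(p). Both ⟨ρ₁,ρ₂,ρ₃⟩ and ⟨ρ₀,ρ₁,ρ₂⟩ contain a nontrivial upper and a nontrivial lower
-- unitriangular matrix (ρ₁ρ₂ = -U(1+ι), ρ₁ρ₃ρ₂ρ₃ = -L(1-ι), ρ₀ρ₂ρ₁ = -L(-1+ι)), and over the prime
-- field these generate SL₂, as X = U(x) L(c) U(z) whenever c ≠ 0. Since ρ₁ρ₂ has order exactly p,
-- maniplexes for distinct primes are not isomorphic, and a prime factor of (n!)⁴ + 1 exceeds n.
--
-- 𝔽ₚ is represented by ℤ[ζ] = ℤ[X]/(X⁴ + 1) modulo the kernel of ζ ↦ N (mod p): identities between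
-- the ρᵢ then hold by evaluation in ℤ[ζ], and polynomial identities by the ring solver for ℤ.

module Submission where

open import Defs
open import Level using (0ℓ)
open import Data.Nat using (ℕ)
open import Data.Product using (Σ; _×_)
open import Relation.Nullary using (¬_)
open import Relation.Binary.PropositionalEquality using (_≢_)

open import Algebra.Bundles using (RawRing; CommutativeRing; Group)
open import Algebra.Structures using (IsCommutativeRing)
open import Algebra.Morphism.Structures using (module MonoidMorphisms; module GroupMorphisms)
open import Data.Bool using (true; false)
open import Data.Empty using (⊥-elim)
open import Data.Fin as Fin using (Fin; toℕ; fromℕ<; #_)
import Data.Fin.Properties as FinP
open import Data.Integer as ℤ using (ℤ; +_; 0ℤ; 1ℤ)
open import Data.Integer.Divisibility.Signed
  using (_∣_; divides; _∣?_; ∣-refl; ∣m∣n⇒∣m+n; ∣m⇒∣-m; ∣m⇒∣m*n; ∣n⇒∣m*n; ∣ᵤ⇒∣; ∣⇒∣ᵤ)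
open import Data.Integer.DivMod using (_%ℕ_; _/ℕ_; n%ℕd<d; a≡a%ℕn+[a/ℕn]*n)
import Data.Integer.Properties as ℤP
open import Data.Integer.Tactic.RingSolver as ℤSolver using (solve-∀)
open import Data.List using (List; []; _∷_; _++_)
import Data.List as List
open import Data.List.Relation.Unary.All using (All; []; _∷_)
import Data.Nat as ℕ
open import Data.Nat.Coprimality using (prime⇒coprime; coprime-Bézout)
open import Data.Nat.Divisibility as ℕ∣ using (divides)
open import Data.Nat.GCD using (module Bézout)
open import Data.Nat.ListAction using (product)
open import Data.Nat.Primality using (Prime; prime⇒nonZero; prime⇒irreducible; euclidsLemma; ¬prime[1])
open import Data.Nat.Primality.Factorisation using (factorise; PrimeFactorisation)
import Data.Nat.Properties as ℕP
open import Data.Product using (∃; ∃-syntax; _,_; proj₁; proj₂)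
open import Data.Sum using (_⊎_; inj₁; inj₂; [_,_]′)
open import Data.Vec as Vec using (Vec; []; _∷_; map)
import Data.Vec.Properties as VecP
open import Function using (_∘_)
open import Relation.Binary.Bundles using (Setoid)
open import Relation.Binary.Definitions using (tri<; tri≈; tri>)
open import Relation.Binary.PropositionalEquality as ≡
  using (_≡_; refl; sym; trans; cong; subst; module ≡-Reasoning)
open import Relation.Binary.Structures using (IsEquivalence)
open import Relation.Nullary using (Dec; yes; no; contradiction)
open import Tactic.RingSolver.Core.Expression using (Expr; Κ; Ι; _⊕_; _⊗_; _⊛_; ⊝_; module Eval)
import Tactic.RingSolver.NonReflective as NonReflective

module Congruence (p : ℕ) where

  open import Data.Integer using (_+_; _-_; _*_; -_)

  infix 4 _≡ₚ_
  record _≡ₚ_ (x y : ℤ) : Set where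
    constructor congruent
    field divisibility : + p ∣ x - y

  ≡⇒≡ₚ : ∀ {x y} → x ≡ y → x ≡ₚ y
  ≡⇒≡ₚ {x} refl = congruent (divides 0ℤ (ℤP.+-inverseʳ x))

  ≡ₚ-sym : ∀ {x y} → x ≡ₚ y → y ≡ₚ x
  ≡ₚ-sym {x} {y} (congruent p∣x-y) = congruent (subst (+ p ∣_) (swap x y) (∣m⇒∣-m p∣x-y))
    where swap : ∀ x y → - (x - y) ≡ y - x
          swap = solve-∀

  ≡ₚ-trans : ∀ {x y z} → x ≡ₚ y → y ≡ₚ z → x ≡ₚ z
  ≡ₚ-trans {x} {y} {z} (congruent p∣x-y) (congruent p∣y-z) =
    congruent (subst (+ p ∣_) (telescope x y z) (∣m∣n⇒∣m+n p∣x-y p∣y-z))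
    where telescope : ∀ x y z → (x - y) + (y - z) ≡ x - z
          telescope = solve-∀

  +-congₚ : ∀ {x y u v} → x ≡ₚ y → u ≡ₚ v → x + u ≡ₚ y + v
  +-congₚ {x} {y} {u} {v} (congruent p∣x-y) (congruent p∣u-v) =
    congruent (subst (+ p ∣_) (regroup x y u v) (∣m∣n⇒∣m+n p∣x-y p∣u-v))
    where regroup : ∀ x y u v → (x - y) + (u - v) ≡ (x + u) - (y + v)
          regroup = solve-∀

  *-congₚ : ∀ {x y u v} → x ≡ₚ y → u ≡ₚ v → x * u ≡ₚ y * v
  *-congₚ {x} {y} {u} {v} (congruent p∣x-y) (congruent p∣u-v) =
    congruent (subst (+ p ∣_) (regroup x y u v) (∣m∣n⇒∣m+n (∣m⇒∣m*n u p∣x-y) (∣n⇒∣m*n y p∣u-v)))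
    where regroup : ∀ x y u v → (x - y) * u + y * (u - v) ≡ x * u - y * v
          regroup = solve-∀

  neg-congₚ : ∀ {x y} → x ≡ₚ y → - x ≡ₚ - y
  neg-congₚ {x} {y} (congruent p∣x-y) = congruent (subst (+ p ∣_) (regroup x y) (∣m⇒∣-m p∣x-y))
    where regroup : ∀ x y → - (x - y) ≡ - x - - y
          regroup = solve-∀

  ∣⇒≡ₚ0 : ∀ {x} → + p ∣ x → x ≡ₚ 0ℤ
  ∣⇒≡ₚ0 {x} p∣x = congruent (subst (+ p ∣_) (sym (ℤP.+-identityʳ x)) p∣x)

  ≡ₚ0⇒∣ : ∀ {x} → x ≡ₚ 0ℤ → + p ∣ x
  ≡ₚ0⇒∣ {x} (congruent p∣x) = subst (+ p ∣_) (ℤP.+-identityʳ x) p∣x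

  small-multiple≡0 : ∀ {x} → ℤ.∣ x ∣ ℕ.< p → + p ∣ x → x ≡ 0ℤ
  small-multiple≡0 {x} ∣x∣<p p∣x with ℤ.∣ x ∣ in ∣x∣≡
  ... | ℕ.zero  = ℤP.∣i∣≡0⇒i≡0 ∣x∣≡
  ... | ℕ.suc _ = contradiction (subst (p ℕ∣.∣_) ∣x∣≡ (∣⇒∣ᵤ p∣x)) (ℕ∣.>⇒∤ ∣x∣<p)

  +-≡ₚ-injective : ∀ {i j} → i ℕ.< p → j ℕ.< p → + i ≡ₚ + j → i ≡ j
  +-≡ₚ-injective {i} {j} i<p j<p (congruent p∣i-j) =
    ℤP.+-injective (ℤP.i-j≡0⇒i≡j (+ i) (+ j) (small-multiple≡0 ∣i-j∣<p p∣i-j))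
    where
      ∣i-j∣<p : ℤ.∣ + i - + j ∣ ℕ.< p
      ∣i-j∣<p = subst (λ d → ℤ.∣ d ∣ ℕ.< p) (sym (ℤP.m-n≡m⊖n i j))
                  (ℕP.≤-<-trans (ℤP.∣m⊝n∣≤m⊔n i j) (ℕP.⊔-lub i<p j<p))

  module _ .{{_ : ℕ.NonZero p}} where

    reduce : ℤ → ℕ
    reduce x = x %ℕ p

    reduce<p : ∀ x → reduce x ℕ.< p
    reduce<p x = n%ℕd<d x p

    reduce-≡ₚ : ∀ x → + reduce x ≡ₚ x
    reduce-≡ₚ x = congruent (divides (- (x /ℕ p)) (begin
      + reduce x - x                              ≡⟨ cong (λ y → + reduce x - y) (a≡a%ℕn+[a/ℕn]*n x p) ⟩
      + reduce x - (+ reduce x + (x /ℕ p) * + p)  ≡⟨ cancel (+ reduce x) (x /ℕ p) (+ p) ⟩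
      - (x /ℕ p) * + p                            ∎))
      where
        open ≡-Reasoning
        cancel : ∀ r q n → r - (r + q * n) ≡ - q * n
        cancel = solve-∀

  module _ (prime : Prime p) where

    private instance
      p≢0 : ℕ.NonZero p
      p≢0 = prime⇒nonZero prime

    euclid : ∀ x y → + p ∣ x * y → + p ∣ x ⊎ + p ∣ y
    euclid x y p∣xy with euclidsLemma ℤ.∣ x ∣ ℤ.∣ y ∣ prime
                           (subst (p ℕ∣.∣_) (ℤP.abs-* x y) (∣⇒∣ᵤ p∣xy))
    ... | inj₁ p∣x = inj₁ (∣ᵤ⇒∣ p∣x)
    ... | inj₂ p∣y = inj₂ (∣ᵤ⇒∣ p∣y)

    private
      pos-affine : ∀ a b c → + (a ℕ.+ b ℕ.* c) ≡ + a + + b * + c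
      pos-affine a b c = trans (ℤP.pos-+ a (b ℕ.* c)) (cong (λ m → + a + m) (ℤP.pos-* b c))

    ≡ₚ-inverse-ℕ : ∀ n .{{_ : ℕ.NonZero n}} → n ℕ.< p → ∃[ y ] + n * y ≡ₚ 1ℤ
    ≡ₚ-inverse-ℕ n n<p with coprime-Bézout (prime⇒coprime prime n<p)
    ... | Bézout.+- a b eq = - + b , congruent (divides (- + a) (begin
      + n * - + b - 1ℤ         ≡⟨ regroup (+ n) (+ b) ⟩
      - (1ℤ + + b * + n)       ≡⟨ cong -_ (sym (pos-affine 1 b n)) ⟩
      - + (1 ℕ.+ b ℕ.* n)      ≡⟨ cong (λ m → - + m) eq ⟩
      - + (a ℕ.* p)            ≡⟨ cong -_ (ℤP.pos-* a p) ⟩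
      - (+ a * + p)            ≡⟨ ℤP.neg-distribˡ-* (+ a) (+ p) ⟩
      - + a * + p              ∎))
      where
        open ≡-Reasoning
        regroup : ∀ n b → n * - b - 1ℤ ≡ - (1ℤ + b * n)
        regroup = solve-∀
    ... | Bézout.-+ a b eq = + b , congruent (divides (+ a) (begin
      + n * + b - 1ℤ              ≡⟨ cong (_- 1ℤ) (ℤP.*-comm (+ n) (+ b)) ⟩
      + b * + n - 1ℤ              ≡⟨ cong (_- 1ℤ) (ℤP.pos-* b n) ⟨
      + (b ℕ.* n) - 1ℤ            ≡⟨ cong (λ m → + m - 1ℤ) eq ⟨
      + (1 ℕ.+ a ℕ.* p) - 1ℤ      ≡⟨ cong (_- 1ℤ) (pos-affine 1 a p) ⟩
      (1ℤ + + a * + p) - 1ℤ       ≡⟨ cancel 1ℤ (+ a * + p) ⟩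
      + a * + p                   ∎))
      where
        open ≡-Reasoning
        cancel : ∀ u v → (u + v) - u ≡ v
        cancel = solve-∀

    ≡ₚ-inverse : ∀ x → ¬ (+ p ∣ x) → ∃[ y ] x * y ≡ₚ 1ℤ
    ≡ₚ-inverse x p∤x = invert (reduce x) (reduce<p x) (reduce-≡ₚ x)
      where
        invert : ∀ r → r ℕ.< p → + r ≡ₚ x → ∃[ y ] x * y ≡ₚ 1ℤ
        invert ℕ.zero    _   0≡x = contradiction (≡ₚ0⇒∣ (≡ₚ-sym 0≡x)) p∤x
        invert (ℕ.suc n) n<p n≡x with ≡ₚ-inverse-ℕ (ℕ.suc n) n<p
        ... | y , ny≡1 = y , ≡ₚ-trans (*-congₚ (≡ₚ-sym n≡x) (≡⇒≡ₚ refl)) ny≡1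

-- a₀ + a₁ ζ + a₂ ζ² + a₃ ζ³ in ℤ[ζ] = ℤ[X]/(X⁴ + 1)
record ℤ[ζ] : Set where
  constructor ⟨_,_,_,_⟩
  field a₀ a₁ a₂ a₃ : ℤ

module _ where
  open import Data.Integer using (_+_; _-_; _*_; -_)

  infixl 6 _+ᶻ_
  infixl 7 _*ᶻ_
  infix  8 -ᶻ_

  _+ᶻ_ : ℤ[ζ] → ℤ[ζ] → ℤ[ζ]
  ⟨ a₀ , a₁ , a₂ , a₃ ⟩ +ᶻ ⟨ b₀ , b₁ , b₂ , b₃ ⟩ = ⟨ a₀ + b₀ , a₁ + b₁ , a₂ + b₂ , a₃ + b₃ ⟩

  -ᶻ_ : ℤ[ζ] → ℤ[ζ]
  -ᶻ ⟨ a₀ , a₁ , a₂ , a₃ ⟩ = ⟨ - a₀ , - a₁ , - a₂ , - a₃ ⟩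

  _*ᶻ_ : ℤ[ζ] → ℤ[ζ] → ℤ[ζ]
  ⟨ a₀ , a₁ , a₂ , a₃ ⟩ *ᶻ ⟨ b₀ , b₁ , b₂ , b₃ ⟩ =
    ⟨ a₀ * b₀ - a₁ * b₃ - a₂ * b₂ - a₃ * b₁
    , a₀ * b₁ + a₁ * b₀ - a₂ * b₃ - a₃ * b₂
    , a₀ * b₂ + a₁ * b₁ + a₂ * b₀ - a₃ * b₃
    , a₀ * b₃ + a₁ * b₂ + a₂ * b₁ + a₃ * b₀ ⟩

  fromℤ : ℤ → ℤ[ζ]
  fromℤ a = ⟨ a , 0ℤ , 0ℤ , 0ℤ ⟩

  0ᶻ 1ᶻ : ℤ[ζ]
  0ᶻ = fromℤ 0ℤ
  1ᶻ = fromℤ 1ℤ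

module Generated {a ℓ} (G : Group a ℓ) where

  open Group G renaming (refl to ≈-refl; sym to ≈-sym; trans to ≈-trans)

  infixr 8 _^_
  _^_ : Carrier → ℕ → Carrier
  x ^ ℕ.zero  = ε
  x ^ ℕ.suc n = x ∙ x ^ n

  ^-cong : ∀ {x y} n → x ≈ y → x ^ n ≈ y ^ n
  ^-cong ℕ.zero    x≈y = ≈-refl
  ^-cong (ℕ.suc n) x≈y = ∙-cong x≈y (^-cong n x≈y)

  evalWord-++ : ∀ {n} (g : Fin n → Carrier) w₁ w₂ →
                evalWord G g (w₁ ++ w₂) ≈ evalWord G g w₁ ∙ evalWord G g w₂
  evalWord-++ g []                 w₂ = ≈-sym (identityˡ _)
  evalWord-++ g ((i , false) ∷ w₁) w₂ = ≈-trans (∙-congˡ (evalWord-++ g w₁ w₂)) (≈-sym (assoc _ _ _))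
  evalWord-++ g ((i , true)  ∷ w₁) w₂ = ≈-trans (∙-congˡ (evalWord-++ g w₁ w₂)) (≈-sym (assoc _ _ _))

  module _ {n} {g : Fin n → Carrier} where

    InGenerated-ε : InGenerated G g ε
    InGenerated-ε = [] , ≈-refl

    InGenerated-∙ : ∀ {x y} → InGenerated G g x → InGenerated G g y → InGenerated G g (x ∙ y)
    InGenerated-∙ (w₁ , w₁≈x) (w₂ , w₂≈y) = w₁ ++ w₂ , ≈-trans (evalWord-++ g w₁ w₂) (∙-cong w₁≈x w₂≈y)

    InGenerated-resp : ∀ {x y} → x ≈ y → InGenerated G g x → InGenerated G g y
    InGenerated-resp x≈y (w , w≈x) = w , ≈-trans w≈x x≈y

    InGenerated-^ : ∀ {x} n → InGenerated G g x → InGenerated G g (x ^ n)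
    InGenerated-^ ℕ.zero    x∈ = InGenerated-ε
    InGenerated-^ (ℕ.suc n) x∈ = InGenerated-∙ x∈ (InGenerated-^ n x∈)

  Generates-reindex : ∀ {m n} (g : Fin n → Carrier) (f : Fin m → Fin n) →
                      Generates G (g ∘ f) → Generates G g
  Generates-reindex g f gen x = List.map (λ (i , inv) → f i , inv) (proj₁ (gen x)) ,
                                ≈-trans (reindex (proj₁ (gen x))) (proj₂ (gen x))
    where
      reindex : ∀ w → evalWord G g (List.map (λ (i , inv) → f i , inv) w) ≈ evalWord G (g ∘ f) w
      reindex []                = ≈-refl
      reindex ((i , false) ∷ w) = ∙-congˡ (reindex w)
      reindex ((i , true)  ∷ w) = ∙-congˡ (reindex w)

module _ {a b ℓ₁ ℓ₂} (G : Group a ℓ₁) (H : Group b ℓ₂) where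

  private
    module G = Group G
    module H = Group H
  open Generated G using () renaming (_^_ to _^₁_)
  open Generated H using (^-cong) renaming (_^_ to _^₂_)
  open MonoidMorphisms G.rawMonoid H.rawMonoid using (IsMonoidHomomorphism)

  module _ {f} (hom : IsMonoidHomomorphism f) where

    open IsMonoidHomomorphism hom

    ^-homo : ∀ x n → f (x ^₁ n) H.≈ f x ^₂ n
    ^-homo x ℕ.zero    = ε-homo
    ^-homo x (ℕ.suc n) = H.trans (homo x (x ^₁ n)) (H.∙-congˡ (^-homo x n))

    ^≈ε-transfer : ∀ {x y} n → f x H.≈ y → x ^₁ n G.≈ G.ε → y ^₂ n H.≈ H.ε
    ^≈ε-transfer {x} n fx≈y xⁿ≈ε =
      H.trans (^-cong n (H.sym fx≈y)) (H.trans (H.sym (^-homo x n)) (H.trans (⟦⟧-cong xⁿ≈ε) ε-homo))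

module ResidueRing (p : ℕ) (N : ℤ) (p∣N⁴+1 : + p ∣ N ℤ.* N ℤ.* N ℤ.* N ℤ.+ 1ℤ) where

  open import Data.Integer using (_+_; _-_; _*_; -_)
  open Congruence p
  private module ℤ-Ops = NonReflective.Ops ℤSolver.ring

  ψ : ℤ[ζ] → ℤ
  ψ ⟨ a₀ , a₁ , a₂ , a₃ ⟩ = a₀ + N * a₁ + N * N * a₂ + N * N * N * a₃

  ψ-+ : ∀ x y → ψ (x +ᶻ y) ≡ ψ x + ψ y
  ψ-+ ⟨ a₀ , a₁ , a₂ , a₃ ⟩ ⟨ b₀ , b₁ , b₂ , b₃ ⟩ = identity N a₀ a₁ a₂ a₃ b₀ b₁ b₂ b₃
    where
      identity : ∀ N a₀ a₁ a₂ a₃ b₀ b₁ b₂ b₃ →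
        (a₀ + b₀) + N * (a₁ + b₁) + N * N * (a₂ + b₂) + N * N * N * (a₃ + b₃)
        ≡ (a₀ + N * a₁ + N * N * a₂ + N * N * N * a₃) + (b₀ + N * b₁ + N * N * b₂ + N * N * N * b₃)
      identity = solve-∀

  ψ-neg : ∀ x → ψ (-ᶻ x) ≡ - ψ x
  ψ-neg ⟨ a₀ , a₁ , a₂ , a₃ ⟩ = identity N a₀ a₁ a₂ a₃
    where
      identity : ∀ N a₀ a₁ a₂ a₃ →
        - a₀ + N * - a₁ + N * N * - a₂ + N * N * N * - a₃ ≡ - (a₀ + N * a₁ + N * N * a₂ + N * N * N * a₃)
      identity = solve-∀

  ψ-fromℤ : ∀ a → ψ (fromℤ a) ≡ a
  ψ-fromℤ a = identity N a
    where
      identity : ∀ N a → a + N * 0ℤ + N * N * 0ℤ + N * N * N * 0ℤ ≡ a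
      identity = solve-∀

  -- ψ (x *ᶻ y) - ψ x * ψ y is the multiple of N⁴ + 1 coming from the reduction ζ⁴ = -1.
  ψ-* : ∀ x y → ψ (x *ᶻ y) ≡ₚ ψ x * ψ y
  ψ-* ⟨ a₀ , a₁ , a₂ , a₃ ⟩ ⟨ b₀ , b₁ , b₂ , b₃ ⟩ =
    congruent (subst (+ p ∣_) (sym (identity N a₀ a₁ a₂ a₃ b₀ b₁ b₂ b₃)) (∣m⇒∣-m (∣n⇒∣m*n q p∣N⁴+1)))
    where
      q : ℤ
      q = a₁ * b₃ + a₂ * b₂ + a₃ * b₁ + N * (a₂ * b₃ + a₃ * b₂) + N * N * (a₃ * b₃)
      identity : ∀ N a₀ a₁ a₂ a₃ b₀ b₁ b₂ b₃ →
        ((a₀ * b₀ - a₁ * b₃ - a₂ * b₂ - a₃ * b₁)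
          + N * (a₀ * b₁ + a₁ * b₀ - a₂ * b₃ - a₃ * b₂)
          + N * N * (a₀ * b₂ + a₁ * b₁ + a₂ * b₀ - a₃ * b₃)
          + N * N * N * (a₀ * b₃ + a₁ * b₂ + a₂ * b₁ + a₃ * b₀))
        - (a₀ + N * a₁ + N * N * a₂ + N * N * N * a₃) * (b₀ + N * b₁ + N * N * b₂ + N * N * N * b₃)
        ≡ - ((a₁ * b₃ + a₂ * b₂ + a₃ * b₁ + N * (a₂ * b₃ + a₃ * b₂) + N * N * (a₃ * b₃))
             * (N * N * N * N + 1ℤ))
      identity = solve-∀

  infix 4 _≈_
  record _≈_ (x y : ℤ[ζ]) : Set where
    constructor via-ψ
    field ψ-≡ₚ : ψ x ≡ₚ ψ y

  ≈-isEquivalence : IsEquivalence _≈_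
  ≈-isEquivalence = record
    { refl  = via-ψ (≡⇒≡ₚ refl)
    ; sym   = λ (via-ψ e) → via-ψ (≡ₚ-sym e)
    ; trans = λ (via-ψ e) (via-ψ f) → via-ψ (≡ₚ-trans e f)
    }

  ≈-refl : ∀ {x} → x ≈ x
  ≈-refl = IsEquivalence.refl ≈-isEquivalence

  ≈-reflexive : ∀ {x y} → x ≡ y → x ≈ y
  ≈-reflexive refl = ≈-refl

  ≈-sym : ∀ {x y} → x ≈ y → y ≈ x
  ≈-sym = IsEquivalence.sym ≈-isEquivalence

  ≈-trans : ∀ {x y z} → x ≈ y → y ≈ z → x ≈ z
  ≈-trans = IsEquivalence.trans ≈-isEquivalence

  ≈-setoid : Setoid 0ℓ 0ℓ
  ≈-setoid = record { isEquivalence = ≈-isEquivalence }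

  rawRing : RawRing 0ℓ 0ℓ
  rawRing = record
    { _≈_ = _≈_ ; _+_ = _+ᶻ_ ; _*_ = _*ᶻ_ ; -_ = -ᶻ_ ; 0# = 0ᶻ ; 1# = 1ᶻ }

  open Eval rawRing fromℤ public using (⟦_⟧)

  ψ-⟦⟧ : ∀ {n} (e : Expr ℤ n) ρ → ψ (⟦ e ⟧ ρ) ≡ₚ ℤ-Ops.⟦ e ⟧ (map ψ ρ)
  ψ-⟦⟧ (Κ a)   ρ = ≡⇒≡ₚ (ψ-fromℤ a)
  ψ-⟦⟧ (Ι i)   ρ = ≡⇒≡ₚ (sym (VecP.lookup-map i ψ ρ))
  ψ-⟦⟧ (e ⊕ f) ρ = ≡ₚ-trans (≡⇒≡ₚ (ψ-+ (⟦ e ⟧ ρ) (⟦ f ⟧ ρ))) (+-congₚ (ψ-⟦⟧ e ρ) (ψ-⟦⟧ f ρ))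
  ψ-⟦⟧ (e ⊗ f) ρ = ≡ₚ-trans (ψ-* (⟦ e ⟧ ρ) (⟦ f ⟧ ρ)) (*-congₚ (ψ-⟦⟧ e ρ) (ψ-⟦⟧ f ρ))
  ψ-⟦⟧ (⊝ e)   ρ = ≡ₚ-trans (≡⇒≡ₚ (ψ-neg (⟦ e ⟧ ρ))) (neg-congₚ (ψ-⟦⟧ e ρ))
  ψ-⟦⟧ (e ⊛ n) ρ = power n (ψ-⟦⟧ e ρ)
    where
      xⁿ : ∀ {n} → ℕ → Expr ℤ (ℕ.suc n)
      xⁿ n = Ι Fin.zero ⊛ n

      power : ∀ n {x a} → ψ x ≡ₚ a → ψ (⟦ xⁿ n ⟧ (x ∷ [])) ≡ₚ ℤ-Ops.⟦ xⁿ n ⟧ (a ∷ [])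
      power 0                     x≡a = ≡⇒≡ₚ (ψ-fromℤ 1ℤ)
      power 1                     x≡a = x≡a
      power (ℕ.suc (ℕ.suc n)) {x} x≡a =
        ≡ₚ-trans (ψ-* (⟦ xⁿ (ℕ.suc n) ⟧ (x ∷ [])) x) (*-congₚ (power (ℕ.suc n) x≡a) x≡a)

  ⟦_⇓⟧ : ∀ {n} → Expr ℤ n → Vec ℤ[ζ] n → ℤ[ζ]
  ⟦ e ⇓⟧ ρ = fromℤ (ℤ-Ops.⟦ e ⇓⟧ (map ψ ρ))

  -- An identity in ℤ[ζ]/≈ is checked by normalising its image under ψ with the ring solver of ℤ.
  ⟦⇓⟧-correct : ∀ {n} (e : Expr ℤ n) ρ → ⟦ e ⇓⟧ ρ ≈ ⟦ e ⟧ ρ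
  ⟦⇓⟧-correct e ρ = via-ψ (≡ₚ-trans (≡⇒≡ₚ (trans (ψ-fromℤ _) (ℤ-Ops.correct e (map ψ ρ))))
                                     (≡ₚ-sym (ψ-⟦⟧ e ρ)))

  open import Relation.Binary.Reflection ≈-setoid Ι ⟦_⟧ ⟦_⇓⟧ ⟦⇓⟧-correct public
    using (solve; prove; _⊜_)

  -- (k , l , r) is the hypothesis l ≈ r, used with cofactor k
  Relation : ℕ → Set
  Relation n = Expr ℤ n × Expr ℤ n × Expr ℤ n

  Holds : ∀ {n} → Vec ℤ[ζ] n → Relation n → Set
  Holds ρ (_ , l , r) = ⟦ l ⟧ ρ ≈ ⟦ r ⟧ ρ

  combination : ∀ {n} → List (Relation n) → Expr ℤ n
  combination []                  = Κ 0ℤ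
  combination ((k , l , r) ∷ rels) = k ⊗ (l ⊕ ⊝ r) ⊕ combination rels

  +ᶻ-cong : ∀ {x y u v} → x ≈ y → u ≈ v → x +ᶻ u ≈ y +ᶻ v
  +ᶻ-cong {x} {y} {u} {v} (via-ψ x≈y) (via-ψ u≈v) =
    via-ψ (≡ₚ-trans (≡⇒≡ₚ (ψ-+ x u)) (≡ₚ-trans (+-congₚ x≈y u≈v) (≡⇒≡ₚ (sym (ψ-+ y v)))))

  *ᶻ-cong : ∀ {x y u v} → x ≈ y → u ≈ v → x *ᶻ u ≈ y *ᶻ v
  *ᶻ-cong {x} {y} {u} {v} (via-ψ x≈y) (via-ψ u≈v) =
    via-ψ (≡ₚ-trans (ψ-* x u) (≡ₚ-trans (*-congₚ x≈y u≈v) (≡ₚ-sym (ψ-* y v))))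

  -ᶻ-cong : ∀ {x y} → x ≈ y → -ᶻ x ≈ -ᶻ y
  -ᶻ-cong {x} {y} (via-ψ x≈y) =
    via-ψ (≡ₚ-trans (≡⇒≡ₚ (ψ-neg x)) (≡ₚ-trans (neg-congₚ x≈y) (≡⇒≡ₚ (sym (ψ-neg y)))))

  isCommutativeRing : IsCommutativeRing _≈_ _+ᶻ_ _*ᶻ_ -ᶻ_ 0ᶻ 1ᶻ
  isCommutativeRing = record
    { isRing = record
      { +-isAbelianGroup = record
        { isGroup = record
          { isMonoid = record
            { isSemigroup = record
              { isMagma = record { isEquivalence = ≈-isEquivalence ; ∙-cong = +ᶻ-cong }
              ; assoc = solve 3 (λ x y z → (x ⊕ y) ⊕ z ⊜ x ⊕ (y ⊕ z)) ≈-refl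
              }
            ; identity = solve 1 (λ x → Κ 0ℤ ⊕ x ⊜ x) ≈-refl , solve 1 (λ x → x ⊕ Κ 0ℤ ⊜ x) ≈-refl
            }
          ; inverse = solve 1 (λ x → ⊝ x ⊕ x ⊜ Κ 0ℤ) ≈-refl , solve 1 (λ x → x ⊕ ⊝ x ⊜ Κ 0ℤ) ≈-refl
          ; ⁻¹-cong = -ᶻ-cong
          }
        ; comm = solve 2 (λ x y → x ⊕ y ⊜ y ⊕ x) ≈-refl
        }
      ; *-cong = *ᶻ-cong
      ; *-assoc = solve 3 (λ x y z → (x ⊗ y) ⊗ z ⊜ x ⊗ (y ⊗ z)) ≈-refl
      ; *-identity = solve 1 (λ x → Κ 1ℤ ⊗ x ⊜ x) ≈-refl , solve 1 (λ x → x ⊗ Κ 1ℤ ⊜ x) ≈-refl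
      ; distrib = solve 3 (λ x y z → x ⊗ (y ⊕ z) ⊜ x ⊗ y ⊕ x ⊗ z) ≈-refl
                , solve 3 (λ x y z → (y ⊕ z) ⊗ x ⊜ y ⊗ x ⊕ z ⊗ x) ≈-refl
      }
    ; *-comm = solve 2 (λ x y → x ⊗ y ⊜ y ⊗ x) ≈-refl
    }

  commutativeRing : CommutativeRing 0ℓ 0ℓ
  commutativeRing = record { isCommutativeRing = isCommutativeRing }

  combination≈0 : ∀ {n} {ρ : Vec ℤ[ζ] n} rels → All (Holds ρ) rels → ⟦ combination rels ⟧ ρ ≈ 0ᶻ
  combination≈0                 []                  []         = ≈-refl
  combination≈0 {ρ = ρ} ((k , l , r) ∷ rels) (l≈r ∷ holds) =
    ≈-trans
      (+ᶻ-cong (*ᶻ-cong (≈-refl {⟦ k ⟧ ρ}) (+ᶻ-cong l≈r ≈-refl)) (combination≈0 rels holds))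
      (solve 2 (λ k r → k ⊗ (r ⊕ ⊝ r) ⊕ Κ 0ℤ ⊜ Κ 0ℤ) ≈-refl (⟦ k ⟧ ρ) (⟦ r ⟧ ρ))

  -- e₁ ≈ e₂ follows from the hypotheses lᵢ ≈ rᵢ once e₁ - e₂ = Σ kᵢ (lᵢ - rᵢ) is an identity over ℤ
  prove-from : ∀ {n} ρ (e₁ e₂ : Expr ℤ n) rels → All (Holds ρ) rels →
               ⟦ e₁ ⇓⟧ ρ ≡ ⟦ e₂ ⊕ combination rels ⇓⟧ ρ → ⟦ e₁ ⟧ ρ ≈ ⟦ e₂ ⟧ ρ
  prove-from ρ e₁ e₂ rels holds certificate =
    ≈-trans (prove ρ e₁ (e₂ ⊕ combination rels) (≈-reflexive certificate))
      (≈-trans (+ᶻ-cong (≈-refl {⟦ e₂ ⟧ ρ}) (combination≈0 rels holds))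
        (solve 1 (λ x → x ⊕ Κ 0ℤ ⊜ x) ≈-refl (⟦ e₂ ⟧ ρ)))

-- N is a primitive 8th root of unity modulo the odd prime p.
record CyclotomicPrime : Set where
  field
    p       : ℕ
    prime   : Prime p
    2<p     : 2 ℕ.< p
    N       : ℤ
    p∣N⁴+1  : + p ∣ N ℤ.* N ℤ.* N ℤ.* N ℤ.+ 1ℤ

module ResidueField (P : CyclotomicPrime) where

  open CyclotomicPrime P
  open Congruence p
  open ResidueRing p N p∣N⁴+1 public
  open CommutativeRing commutativeRing public
    using ( _+_; _*_; -_; _-_; 0#; 1#; _≉_; setoid; +-rawMonoid
          ; +-cong; *-cong; -‿cong; *-assoc; *-identityʳ; *-comm; zeroˡ )
  open import Algebra.Definitions.RawMonoid +-rawMonoid public using () renaming (_×_ to _×ₙ_)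
  open import Relation.Binary.Reasoning.Setoid setoid

  private instance
    p≢0 : ℕ.NonZero p
    p≢0 = prime⇒nonZero prime

  ψ-0# : ψ 0# ≡ 0ℤ
  ψ-0# = ψ-fromℤ 0ℤ

  ≈0⇒p∣ψ : ∀ {x} → x ≈ 0# → + p ∣ ψ x
  ≈0⇒p∣ψ {x} (via-ψ e) = ≡ₚ0⇒∣ (subst (ψ x ≡ₚ_) ψ-0# e)

  p∣ψ⇒≈0 : ∀ {x} → + p ∣ ψ x → x ≈ 0#
  p∣ψ⇒≈0 {x} p∣ψx = via-ψ (subst (ψ x ≡ₚ_) (sym ψ-0#) (∣⇒≡ₚ0 p∣ψx))

  _≈0? : ∀ x → Dec (x ≈ 0#)
  x ≈0? with + p ∣? ψ x
  ... | yes p∣ψx = yes (p∣ψ⇒≈0 p∣ψx)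
  ... | no  p∤ψx = no (λ x≈0 → p∤ψx (≈0⇒p∣ψ x≈0))

  fromℕ≉0 : ∀ n → 0 ℕ.< n → n ℕ.< p → fromℤ (+ n) ≉ 0#
  fromℕ≉0 n 0<n n<p n≈0 = ℕP.<⇒≱ n<p (ℕ∣.∣⇒≤ ⦃ ℕ.>-nonZero 0<n ⦄ (∣⇒∣ᵤ p∣n))
    where
      p∣n : + p ∣ + n
      p∣n = subst (+ p ∣_) (ψ-fromℤ (+ n)) (≈0⇒p∣ψ n≈0)

  2≉0 : 1# + 1# ≉ 0#
  2≉0 = fromℕ≉0 2 (ℕ.s≤s ℕ.z≤n) 2<p

  fromℤ-reduce : ∀ x → fromℤ (+ reduce (ψ x)) ≈ x
  fromℤ-reduce x = via-ψ (subst (_≡ₚ ψ x) (sym (ψ-fromℤ _)) (reduce-≡ₚ (ψ x)))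

  isField : IsField commutativeRing
  isField = record { 0≉1 = 0≉1 ; inverse = inverse }
    where
      0≉1 : 0# ≉ 1#
      0≉1 0≈1 = fromℕ≉0 1 (ℕ.s≤s ℕ.z≤n) (ℕP.<-trans (ℕ.s≤s (ℕ.s≤s ℕ.z≤n)) 2<p) (≈-sym 0≈1)

      inverse : ∀ x → x ≉ 0# → ∃[ y ] x * y ≈ 1#
      inverse x x≉0 with ≡ₚ-inverse prime (ψ x) (λ p∣ψx → x≉0 (p∣ψ⇒≈0 p∣ψx))
      ... | y , xy≡1 = fromℤ y , via-ψ (≡ₚ-trans (ψ-* x (fromℤ y))
                                   (subst (λ z → ψ x ℤ.* z ≡ₚ ψ 1#) (sym (ψ-fromℤ y))
                                     (subst (ψ x ℤ.* y ≡ₚ_) (sym (ψ-fromℤ 1ℤ)) xy≡1)))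

  hasOrder : HasOrder commutativeRing p
  hasOrder = enumerate , injective , surjective
    where
      enumerate : Fin p → ℤ[ζ]
      enumerate i = fromℤ (+ toℕ i)

      injective : ∀ {i j} → enumerate i ≈ enumerate j → i ≡ j
      injective {i} {j} (via-ψ e) = FinP.toℕ-injective (+-≡ₚ-injective (FinP.toℕ<n i) (FinP.toℕ<n j)
        (subst (_≡ₚ + toℕ j) (ψ-fromℤ (+ toℕ i)) (subst (ψ (enumerate i) ≡ₚ_) (ψ-fromℤ (+ toℕ j)) e)))

      surjective : ∀ y → ∃[ i ] ∀ {j} → j ≡ i → enumerate j ≈ y
      surjective y = fromℕ< (reduce<p (ψ y)) , λ { refl →
        subst (λ n → fromℤ (+ n) ≈ y) (sym (FinP.toℕ-fromℕ< (reduce<p (ψ y)))) (fromℤ-reduce y) }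

  ψ-×ₙ : ∀ n x → ψ (n ×ₙ x) ≡ + n ℤ.* ψ x
  ψ-×ₙ ℕ.zero    x = ψ-0#
  ψ-×ₙ (ℕ.suc n) x =
    trans (ψ-+ x (n ×ₙ x)) (trans (cong (λ z → ψ x ℤ.+ z) (ψ-×ₙ n x)) (regroup (ψ x) (+ n)))
    where
      regroup : ∀ y m → y ℤ.+ m ℤ.* y ≡ (1ℤ ℤ.+ m) ℤ.* y
      regroup = solve-∀

  p×ₙx≈0 : ∀ x → p ×ₙ x ≈ 0#
  p×ₙx≈0 x = p∣ψ⇒≈0 (subst (+ p ∣_) (sym (ψ-×ₙ p x)) (∣m⇒∣m*n (ψ x) (∣-refl {+ p})))

  n×ₙx≈0⇒p∣n : ∀ n {x} → x ≉ 0# → n ×ₙ x ≈ 0# → p ℕ∣.∣ n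
  n×ₙx≈0⇒p∣n n {x} x≉0 nx≈0 with euclid prime (+ n) (ψ x) (subst (+ p ∣_) (ψ-×ₙ n x) (≈0⇒p∣ψ nx≈0))
  ... | inj₁ p∣n = ∣⇒∣ᵤ p∣n
  ... | inj₂ p∣ψx = contradiction (p∣ψ⇒≈0 p∣ψx) x≉0

  ×ₙ≈fromℕ* : ∀ n x → n ×ₙ x ≈ fromℤ (+ n) * x
  ×ₙ≈fromℕ* n x = via-ψ (≡ₚ-trans (≡⇒≡ₚ (trans (ψ-×ₙ n x) (cong (ℤ._* ψ x) (sym (ψ-fromℤ (+ n))))))
                                  (≡ₚ-sym (ψ-* (fromℤ (+ n)) x)))

  ×ₙ-surjective : ∀ {c} → c ≉ 0# → ∀ t → ∃[ n ] n ×ₙ c ≈ t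
  ×ₙ-surjective {c} c≉0 t = n , (begin
    n ×ₙ c            ≈⟨ ×ₙ≈fromℕ* n c ⟩
    fromℤ (+ n) * c   ≈⟨ *-cong (fromℤ-reduce (t * y)) ≈-refl ⟩
    (t * y) * c       ≈⟨ *-assoc t y c ⟩
    t * (y * c)       ≈⟨ *-cong (≈-refl {t}) (≈-trans (*-comm y c) cy≈1) ⟩
    t * 1#            ≈⟨ *-identityʳ t ⟩
    t                 ∎)
    where
      y : ℤ[ζ]
      y = proj₁ (IsField.inverse isField c c≉0)
      cy≈1 : c * y ≈ 1#
      cy≈1 = proj₂ (IsField.inverse isField c c≉0)
      n : ℕ
      n = reduce (ψ (t * y))

module PSL₂ (P : CyclotomicPrime) where

  open ResidueField P public

  F : CommutativeRing 0ℓ 0ℓ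
  F = commutativeRing

  Matrix : Set
  Matrix = Mat2 F

  infix  4 _≋_
  infixl 7 _·ₘ_
  infix  8 -ₘ_

  _≋_ : Matrix → Matrix → Set
  _≋_ = _≈ₘ_ F

  _·ₘ_ : Matrix → Matrix → Matrix
  _·ₘ_ = _·_ F

  -ₘ_ : Matrix → Matrix
  -ₘ mat a b c d = mat (- a) (- b) (- c) (- d)

  adj : Matrix → Matrix
  adj (mat a b c d) = mat d (- b) (- c) a

  entries : Matrix → Vec ℤ[ζ] 4
  entries (mat a b c d) = a ∷ b ∷ c ∷ d ∷ []

  ≋-refl : ∀ {M} → M ≋ M
  ≋-refl = ≈-refl , ≈-refl , ≈-refl , ≈-refl

  ≋-sym : ∀ {M N} → M ≋ N → N ≋ M
  ≋-sym {mat _ _ _ _} {mat _ _ _ _} (a , b , c , d) = ≈-sym a , ≈-sym b , ≈-sym c , ≈-sym d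

  ≋-trans : ∀ {M N K} → M ≋ N → N ≋ K → M ≋ K
  ≋-trans {mat _ _ _ _} {mat _ _ _ _} {mat _ _ _ _} (a , b , c , d) (a′ , b′ , c′ , d′) =
    ≈-trans a a′ , ≈-trans b b′ , ≈-trans c c′ , ≈-trans d d′

  ·-cong : ∀ {M M′ N N′} → M ≋ M′ → N ≋ N′ → M ·ₘ N ≋ M′ ·ₘ N′
  ·-cong {mat _ _ _ _} {mat _ _ _ _} {mat _ _ _ _} {mat _ _ _ _} (a , b , c , d) (a′ , b′ , c′ , d′) =
    +-cong (*-cong a a′) (*-cong b c′) , +-cong (*-cong a b′) (*-cong b d′) ,
    +-cong (*-cong c a′) (*-cong d c′) , +-cong (*-cong c b′) (*-cong d d′)

  -ₘ-cong : ∀ {M N} → M ≋ N → -ₘ M ≋ -ₘ N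
  -ₘ-cong {mat _ _ _ _} {mat _ _ _ _} (a , b , c , d) = -‿cong a , -‿cong b , -‿cong c , -‿cong d

  adj-cong : ∀ {M N} → M ≋ N → adj M ≋ adj N
  adj-cong {mat _ _ _ _} {mat _ _ _ _} (a , b , c , d) = d , -‿cong b , -‿cong c , a

  record MatExpr (n : ℕ) : Set where
    constructor matₑ
    field aₑ bₑ cₑ dₑ : Expr ℤ n

  infixl 7 _·ₑ_
  _·ₑ_ : ∀ {n} → MatExpr n → MatExpr n → MatExpr n
  matₑ a b c d ·ₑ matₑ a′ b′ c′ d′ =
    matₑ (a ⊗ a′ ⊕ b ⊗ c′) (a ⊗ b′ ⊕ b ⊗ d′) (c ⊗ a′ ⊕ d ⊗ c′) (c ⊗ b′ ⊕ d ⊗ d′)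

  -ₑ_ : ∀ {n} → MatExpr n → MatExpr n
  -ₑ matₑ a b c d = matₑ (⊝ a) (⊝ b) (⊝ c) (⊝ d)

  adjₑ : ∀ {n} → MatExpr n → MatExpr n
  adjₑ (matₑ a b c d) = matₑ d (⊝ b) (⊝ c) a

  detₑ : ∀ {n} → MatExpr n → Expr ℤ n
  detₑ (matₑ a b c d) = a ⊗ d ⊕ ⊝ (b ⊗ c)

  scalarₑ : ∀ {n} → Expr ℤ n → MatExpr n
  scalarₑ e = matₑ e (Κ 0ℤ) (Κ 0ℤ) e

  𝐀 : ∀ {n} → MatExpr (4 ℕ.+ n)
  𝐀 = matₑ (Ι (# 0)) (Ι (# 1)) (Ι (# 2)) (Ι (# 3))

  𝐁 : ∀ {n} → MatExpr (8 ℕ.+ n)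
  𝐁 = matₑ (Ι (# 4)) (Ι (# 5)) (Ι (# 6)) (Ι (# 7))

  𝐂 : ∀ {n} → MatExpr (12 ℕ.+ n)
  𝐂 = matₑ (Ι (# 8)) (Ι (# 9)) (Ι (# 10)) (Ι (# 11))

  ⟦_⟧ₘ ⟦_⇓⟧ₘ : ∀ {n} → MatExpr n → Vec ℤ[ζ] n → Matrix
  ⟦ matₑ a b c d ⟧ₘ  ρ = mat (⟦ a ⟧ ρ) (⟦ b ⟧ ρ) (⟦ c ⟧ ρ) (⟦ d ⟧ ρ)
  ⟦ matₑ a b c d ⇓⟧ₘ ρ = mat (⟦ a ⇓⟧ ρ) (⟦ b ⇓⟧ ρ) (⟦ c ⇓⟧ ρ) (⟦ d ⇓⟧ ρ)

  prove-≋ : ∀ {n} ρ (E₁ E₂ : MatExpr n) → ⟦ E₁ ⇓⟧ₘ ρ ≡ ⟦ E₂ ⇓⟧ₘ ρ → ⟦ E₁ ⟧ₘ ρ ≋ ⟦ E₂ ⟧ₘ ρ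
  prove-≋ ρ (matₑ a b c d) (matₑ a′ b′ c′ d′) eq =
    prove ρ a a′ (≈-reflexive (cong Mat2.a eq)) , prove ρ b b′ (≈-reflexive (cong Mat2.b eq)) ,
    prove ρ c c′ (≈-reflexive (cong Mat2.c' eq)) , prove ρ d d′ (≈-reflexive (cong Mat2.d eq))

  ·-assoc : ∀ M N K → (M ·ₘ N) ·ₘ K ≋ M ·ₘ (N ·ₘ K)
  ·-assoc M N K = prove-≋ (entries M Vec.++ entries N Vec.++ entries K)
                    ((𝐀 ·ₑ 𝐁) ·ₑ 𝐂) (𝐀 ·ₑ (𝐁 ·ₑ 𝐂)) refl

  ·-identityˡ : ∀ M → I₂ F ·ₘ M ≋ M
  ·-identityˡ M = prove-≋ (entries M) (scalarₑ (Κ 1ℤ) ·ₑ 𝐀) 𝐀 refl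

  ·-identityʳ : ∀ M → M ·ₘ I₂ F ≋ M
  ·-identityʳ M = prove-≋ (entries M) (𝐀 ·ₑ scalarₑ (Κ 1ℤ)) 𝐀 refl

  -ₘ-involutive : ∀ M → -ₘ -ₘ M ≋ M
  -ₘ-involutive M = prove-≋ (entries M) (-ₑ -ₑ 𝐀) 𝐀 refl

  -ₘ-·ˡ : ∀ M N → (-ₘ M) ·ₘ N ≋ -ₘ (M ·ₘ N)
  -ₘ-·ˡ M N = prove-≋ (entries M Vec.++ entries N) ((-ₑ 𝐀) ·ₑ 𝐁) (-ₑ (𝐀 ·ₑ 𝐁)) refl

  -ₘ-·ʳ : ∀ M N → M ·ₘ (-ₘ N) ≋ -ₘ (M ·ₘ N)
  -ₘ-·ʳ M N = prove-≋ (entries M Vec.++ entries N) (𝐀 ·ₑ (-ₑ 𝐁)) (-ₑ (𝐀 ·ₑ 𝐁)) refl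

  adj-ₘ : ∀ M → adj (-ₘ M) ≋ -ₘ adj M
  adj-ₘ M = prove-≋ (entries M) (adjₑ (-ₑ 𝐀)) (-ₑ adjₑ 𝐀) refl

  det-· : ∀ M N → det F (M ·ₘ N) ≈ det F M * det F N
  det-· M N = prove (entries M Vec.++ entries N) (detₑ (𝐀 ·ₑ 𝐁)) (detₑ 𝐀 ⊗ detₑ 𝐁) ≈-refl

  det-adj : ∀ M → det F (adj M) ≈ det F M
  det-adj M = prove (entries M) (detₑ (adjₑ 𝐀)) (detₑ 𝐀) ≈-refl

  adj-inverseˡ : ∀ M → det F M ≈ 1# → adj M ·ₘ M ≋ I₂ F
  adj-inverseˡ M det≈1 = ≋-trans (prove-≋ (entries M) (adjₑ 𝐀 ·ₑ 𝐀) (scalarₑ (detₑ 𝐀)) refl)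
                                 (det≈1 , ≈-refl , ≈-refl , det≈1)

  adj-inverseʳ : ∀ M → det F M ≈ 1# → M ·ₘ adj M ≋ I₂ F
  adj-inverseʳ M det≈1 = ≋-trans (prove-≋ (entries M) (𝐀 ·ₑ adjₑ 𝐀) (scalarₑ (detₑ 𝐀)) refl)
                                 (det≈1 , ≈-refl , ≈-refl , det≈1)

  entry : Fin 4 → Matrix → ℤ[ζ]
  entry k M = Vec.lookup (entries M) k

  ≋-entry : ∀ k {M N} → M ≋ N → entry k M ≈ entry k N
  ≋-entry Fin.zero                               {mat _ _ _ _} {mat _ _ _ _} (a , _ , _ , _) = a
  ≋-entry (Fin.suc Fin.zero)                     {mat _ _ _ _} {mat _ _ _ _} (_ , b , _ , _) = b
  ≋-entry (Fin.suc (Fin.suc Fin.zero))           {mat _ _ _ _} {mat _ _ _ _} (_ , _ , c , _) = c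
  ≋-entry (Fin.suc (Fin.suc (Fin.suc Fin.zero))) {mat _ _ _ _} {mat _ _ _ _} (_ , _ , _ , d) = d

  -ₘ-preserves-zero : ∀ k M → entry k M ≈ 0# → entry k (-ₘ M) ≈ 0#
  -ₘ-preserves-zero Fin.zero                               (mat _ _ _ _) = -‿cong
  -ₘ-preserves-zero (Fin.suc Fin.zero)                     (mat _ _ _ _) = -‿cong
  -ₘ-preserves-zero (Fin.suc (Fin.suc Fin.zero))           (mat _ _ _ _) = -‿cong
  -ₘ-preserves-zero (Fin.suc (Fin.suc (Fin.suc Fin.zero))) (mat _ _ _ _) = -‿cong

  SL : Set
  SL = SL₂ F

  infix 4 _≈±_
  data _≈±_ (X Y : SL) : Set where
    same     : proj₁ X ≋ proj₁ Y → X ≈± Y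
    opposite : proj₁ X ≋ -ₘ proj₁ Y → X ≈± Y

  -- Opaque, so that comparing elements of SL never unfolds proofs of det ≈ 1.
  opaque
    det-·≈1 : ∀ M N → det F M ≈ 1# → det F N ≈ 1# → det F (M ·ₘ N) ≈ 1#
    det-·≈1 M N det-M≈1 det-N≈1 = ≈-trans (det-· M N) (*-cong det-M≈1 det-N≈1)

    det-adj≈1 : ∀ M → det F M ≈ 1# → det F (adj M) ≈ 1#
    det-adj≈1 M = ≈-trans (det-adj M)

  infixl 7 _∙_
  _∙_ : SL → SL → SL
  (M , det-M≈1) ∙ (N , det-N≈1) = M ·ₘ N , det-·≈1 M N det-M≈1 det-N≈1

  ε : SL
  ε = I₂ F , ≈-refl

  _⁻¹ : SL → SL
  (M , det-M≈1) ⁻¹ = adj M , det-adj≈1 M det-M≈1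

  ≈±-refl : ∀ {X} → X ≈± X
  ≈±-refl = same ≋-refl

  ≈±-sym : ∀ {X Y} → X ≈± Y → Y ≈± X
  ≈±-sym         (same X≋Y)     = same (≋-sym X≋Y)
  ≈±-sym {Y = Y} (opposite X≋-Y) =
    opposite (≋-trans (≋-sym (-ₘ-involutive (proj₁ Y))) (-ₘ-cong (≋-sym X≋-Y)))

  ≈±-trans : ∀ {X Y Z} → X ≈± Y → Y ≈± Z → X ≈± Z
  ≈±-trans         (same X≋Y)      (same Y≋Z)      = same (≋-trans X≋Y Y≋Z)
  ≈±-trans         (same X≋Y)      (opposite Y≋-Z) = opposite (≋-trans X≋Y Y≋-Z)
  ≈±-trans         (opposite X≋-Y) (same Y≋Z)      = opposite (≋-trans X≋-Y (-ₘ-cong Y≋Z))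
  ≈±-trans {Z = Z} (opposite X≋-Y) (opposite Y≋-Z) =
    same (≋-trans X≋-Y (≋-trans (-ₘ-cong Y≋-Z) (-ₘ-involutive (proj₁ Z))))

  ∙-cong : ∀ {X X′ Y Y′} → X ≈± X′ → Y ≈± Y′ → X ∙ Y ≈± X′ ∙ Y′
  ∙-cong (same X≋X′) (same Y≋Y′) = same (·-cong X≋X′ Y≋Y′)
  ∙-cong {X′ = X′} {Y′ = Y′} (same X≋X′) (opposite Y≋-Y′) =
    opposite (≋-trans (·-cong X≋X′ Y≋-Y′) (-ₘ-·ʳ (proj₁ X′) (proj₁ Y′)))
  ∙-cong {X′ = X′} {Y′ = Y′} (opposite X≋-X′) (same Y≋Y′) =
    opposite (≋-trans (·-cong X≋-X′ Y≋Y′) (-ₘ-·ˡ (proj₁ X′) (proj₁ Y′)))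
  ∙-cong {X′ = X′} {Y′ = Y′} (opposite X≋-X′) (opposite Y≋-Y′) =
    same (≋-trans (·-cong X≋-X′ Y≋-Y′) (≋-trans (-ₘ-·ˡ M (-ₘ N))
           (≋-trans (-ₘ-cong (-ₘ-·ʳ M N)) (-ₘ-involutive (M ·ₘ N)))))
    where
      M N : Matrix
      M = proj₁ X′
      N = proj₁ Y′

  ⁻¹-cong : ∀ {X Y} → X ≈± Y → X ⁻¹ ≈± Y ⁻¹
  ⁻¹-cong         (same X≋Y)      = same (adj-cong X≋Y)
  ⁻¹-cong {Y = Y} (opposite X≋-Y) = opposite (≋-trans (adj-cong X≋-Y) (adj-ₘ (proj₁ Y)))

  group : Group 0ℓ 0ℓ
  group = record
    { Carrier = SL ; _≈_ = _≈±_ ; _∙_ = _∙_ ; ε = ε ; _⁻¹ = _⁻¹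
    ; isGroup = record
      { isMonoid = record
        { isSemigroup = record
          { isMagma = record
            { isEquivalence = record { refl = ≈±-refl ; sym = ≈±-sym ; trans = ≈±-trans }
            ; ∙-cong = ∙-cong
            }
          ; assoc = λ X Y Z → same (·-assoc (proj₁ X) (proj₁ Y) (proj₁ Z))
          }
        ; identity = (λ X → same (·-identityˡ (proj₁ X))) , (λ X → same (·-identityʳ (proj₁ X)))
        }
      ; inverse = (λ (M , det≈1) → same (adj-inverseˡ M det≈1))
                , (λ (M , det≈1) → same (adj-inverseʳ M det≈1))
      ; ⁻¹-cong = ⁻¹-cong
      }
    }

  ≈±-preserves-zero : ∀ k {X Y} → X ≈± Y → entry k (proj₁ X) ≈ 0# → entry k (proj₁ Y) ≈ 0#
  ≈±-preserves-zero k         (same X≋Y)      x≈0 = ≈-trans (≈-sym (≋-entry k X≋Y)) x≈0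
  ≈±-preserves-zero k {Y = Y} (opposite X≋-Y) x≈0 =
    ≈-trans (≈-sym (≋-entry k (-ₘ-involutive (proj₁ Y))))
            (-ₘ-preserves-zero k (-ₘ proj₁ Y) (≈-trans (≈-sym (≋-entry k X≋-Y)) x≈0))

  open Generated group public

  group≅PSL₂ : IsoToPSL₂ group F
  group≅PSL₂ = (λ X → X) , (λ _ _ → same) , (λ _ _ _ → same) , (λ X → X , ≈±-refl) , kernel , kernel⁻¹
    where
      kernel : ∀ X → X ≈± ε → proj₁ X ≋ I₂ F ⊎ proj₁ X ≋ -I₂ F
      kernel X (same X≋I)      = inj₁ X≋I
      kernel X (opposite X≋-I) = inj₂ X≋-I

      kernel⁻¹ : ∀ X → proj₁ X ≋ I₂ F ⊎ proj₁ X ≋ -I₂ F → X ≈± ε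
      kernel⁻¹ X (inj₁ X≋I)  = same X≋I
      kernel⁻¹ X (inj₂ X≋-I) = opposite X≋-I

module Generation (P : CyclotomicPrime) where

  open PSL₂ P public

  Uₑ Lₑ : ∀ {n} → Expr ℤ n → MatExpr n
  Uₑ t = matₑ (Κ 1ℤ) t (Κ 0ℤ) (Κ 1ℤ)
  Lₑ t = matₑ (Κ 1ℤ) (Κ 0ℤ) t (Κ 1ℤ)

  opaque
    det-U≈1 : ∀ t → det F (mat 1# t 0# 1#) ≈ 1#
    det-U≈1 t = prove (t ∷ []) (detₑ (Uₑ (Ι (# 0)))) (Κ 1ℤ) ≈-refl

    det-L≈1 : ∀ t → det F (mat 1# 0# t 1#) ≈ 1#
    det-L≈1 t = prove (t ∷ []) (detₑ (Lₑ (Ι (# 0)))) (Κ 1ℤ) ≈-refl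

  U L : ℤ[ζ] → SL
  U t = mat 1# t 0# 1# , det-U≈1 t
  L t = mat 1# 0# t 1# , det-L≈1 t

  U-+ : ∀ s t → U s ∙ U t ≈± U (s + t)
  U-+ s t = same (prove-≋ (s ∷ t ∷ []) (Uₑ (Ι (# 0)) ·ₑ Uₑ (Ι (# 1))) (Uₑ (Ι (# 0) ⊕ Ι (# 1))) refl)

  L-+ : ∀ s t → L s ∙ L t ≈± L (s + t)
  L-+ s t = same (prove-≋ (s ∷ t ∷ []) (Lₑ (Ι (# 0)) ·ₑ Lₑ (Ι (# 1))) (Lₑ (Ι (# 0) ⊕ Ι (# 1))) refl)

  U-cong : ∀ {s t} → s ≈ t → U s ≈± U t
  U-cong s≈t = same (≈-refl , s≈t , ≈-refl , ≈-refl)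

  L-cong : ∀ {s t} → s ≈ t → L s ≈± L t
  L-cong s≈t = same (≈-refl , ≈-refl , s≈t , ≈-refl)

  U-^ : ∀ c n → U c ^ n ≈± U (n ×ₙ c)
  U-^ c ℕ.zero    = same ≋-refl
  U-^ c (ℕ.suc n) = ≈±-trans (∙-cong (≈±-refl {U c}) (U-^ c n)) (U-+ c (n ×ₙ c))

  L-^ : ∀ c n → L c ^ n ≈± L (n ×ₙ c)
  L-^ c ℕ.zero    = same ≋-refl
  L-^ c (ℕ.suc n) = ≈±-trans (∙-cong (≈±-refl {L c}) (L-^ c n)) (L-+ c (n ×ₙ c))

  -- a b      1  x     1  0     1  z
  -- c d  =   0  1  ·  c  1  ·  0  1     with x = (a - 1)/c and z = (d - 1)/c
  U-L-U-decomposition : ∀ a b c d (det≈1 : det F (mat a b c d) ≈ 1#) {y} → c * y ≈ 1# →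
                        (mat a b c d , det≈1) ≈± U ((a - 1#) * y) ∙ (L c ∙ U ((d - 1#) * y))
  U-L-U-decomposition a b c d det≈1 {y} cy≈1 = same
    ( prove-from ρ aₑ (MatExpr.aₑ 𝐏) ((⊝ (aₑ ⊕ ⊝ 1ₑ) , cy , 1ₑ) ∷ []) (cy≈1 ∷ []) refl
    , prove-from ρ bₑ (MatExpr.bₑ 𝐏)
        ((⊝ (bₑ ⊕ (aₑ ⊕ ⊝ 1ₑ) ⊗ (dₑ ⊕ ⊝ 1ₑ) ⊗ yₑ) , cy , 1ₑ) ∷ (⊝ yₑ , detₑ 𝐀 , 1ₑ) ∷ [])
        (cy≈1 ∷ det≈1 ∷ []) refl
    , prove-from ρ cₑ (MatExpr.cₑ 𝐏) [] [] refl
    , prove-from ρ dₑ (MatExpr.dₑ 𝐏) ((⊝ (dₑ ⊕ ⊝ 1ₑ) , cy , 1ₑ) ∷ []) (cy≈1 ∷ []) refl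
    )
    where
      ρ : Vec ℤ[ζ] 5
      ρ = a ∷ b ∷ c ∷ d ∷ y ∷ []
      aₑ bₑ cₑ dₑ yₑ 1ₑ cy : Expr ℤ 5
      aₑ = Ι (# 0)
      bₑ = Ι (# 1)
      cₑ = Ι (# 2)
      dₑ = Ι (# 3)
      yₑ = Ι (# 4)
      1ₑ = Κ 1ℤ
      cy = cₑ ⊗ yₑ
      𝐏 : MatExpr 5
      𝐏 = Uₑ ((aₑ ⊕ ⊝ 1ₑ) ⊗ yₑ) ·ₑ (Lₑ cₑ ·ₑ Uₑ ((dₑ ⊕ ⊝ 1ₑ) ⊗ yₑ))

  L-shear-c≉0 : ∀ a b c d (det≈1 : det F (mat a b c d) ≈ 1#) → c ≈ 0# →
                Mat2.c' (proj₁ (L 1# ∙ (mat a b c d , det≈1))) ≉ 0#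
  L-shear-c≉0 a b c d det≈1 c≈0 a+c≈0 = IsField.0≉1 isField (≈-sym (prove-from ρ (Κ 1ℤ) (Κ 0ℤ)
    ((⊝ Κ 1ℤ , detₑ 𝐀 , Κ 1ℤ) ∷ (dₑ , Κ 1ℤ ⊗ aₑ ⊕ Κ 1ℤ ⊗ cₑ , Κ 0ℤ) ∷ (⊝ (bₑ ⊕ dₑ) , cₑ , Κ 0ℤ) ∷ [])
    (det≈1 ∷ a+c≈0 ∷ c≈0 ∷ []) refl))
    where
      ρ : Vec ℤ[ζ] 4
      ρ = a ∷ b ∷ c ∷ d ∷ []
      aₑ bₑ cₑ dₑ : Expr ℤ 4
      aₑ = Ι (# 0)
      bₑ = Ι (# 1)
      cₑ = Ι (# 2)
      dₑ = Ι (# 3)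

  module _ {n} {g : Fin n → SL} where

    private
      H : SL → Set
      H = InGenerated group g

    U-all : ∀ {c} → c ≉ 0# → H (U c) → ∀ t → H (U t)
    U-all {c} c≉0 Uc∈H t =
      let k , kc≈t = ×ₙ-surjective c≉0 t
      in  InGenerated-resp (≈±-trans (U-^ c k) (U-cong kc≈t)) (InGenerated-^ k Uc∈H)

    L-all : ∀ {c} → c ≉ 0# → H (L c) → ∀ t → H (L t)
    L-all {c} c≉0 Lc∈H t =
      let k , kc≈t = ×ₙ-surjective c≉0 t
      in  InGenerated-resp (≈±-trans (L-^ c k) (L-cong kc≈t)) (InGenerated-^ k Lc∈H)

    generated-by-unitriangulars : ∀ {c c′} → c ≉ 0# → c′ ≉ 0# → H (U c) → H (L c′) → Generates group g
    generated-by-unitriangulars c≉0 c′≉0 Uc∈H Lc′∈H X = by-cases X (Mat2.c' (proj₁ X) ≈0?)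
      where
        U∈H : ∀ t → H (U t)
        U∈H = U-all c≉0 Uc∈H

        L∈H : ∀ t → H (L t)
        L∈H = L-all c′≉0 Lc′∈H

        when-c≉0 : ∀ X → Mat2.c' (proj₁ X) ≉ 0# → H X
        when-c≉0 (mat a b c d , det≈1) c≉0 =
          InGenerated-resp (≈±-sym (U-L-U-decomposition a b c d det≈1 cy≈1))
            (InGenerated-∙ (U∈H _) (InGenerated-∙ (L∈H c) (U∈H _)))
          where
            cy≈1 : c * proj₁ (IsField.inverse isField c c≉0) ≈ 1#
            cy≈1 = proj₂ (IsField.inverse isField c c≉0)

        by-cases : ∀ X → Dec (Mat2.c' (proj₁ X) ≈ 0#) → H X
        by-cases X (no c≉0) = when-c≉0 X c≉0
        by-cases X@(M@(mat a b c d) , det≈1) (yes c≈0) =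
          InGenerated-resp (same (prove-≋ (entries M) (Lₑ (⊝ Κ 1ℤ) ·ₑ (Lₑ (Κ 1ℤ) ·ₑ 𝐀)) 𝐀 refl))
            (InGenerated-∙ (L∈H (- 1#)) (when-c≉0 (L 1# ∙ X) (L-shear-c≉0 a b c d det≈1 c≈0)))

module Maniplex (P : CyclotomicPrime) where

  open CyclotomicPrime P using (p; prime)
  open Generation P public
  open import Data.Fin using (zero; suc)

  ζ ι : ℤ[ζ]
  ζ = ⟨ 0ℤ , 1ℤ , 0ℤ , 0ℤ ⟩
  ι = ζ * ζ

  *-≉0ˡ : ∀ {x y} → x * y ≉ 0# → x ≉ 0#
  *-≉0ˡ {x} {y} xy≉0 x≈0 = xy≉0 (≈-trans (*-cong x≈0 (≈-refl {y})) (zeroˡ y))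

  1≉0 : 1# ≉ 0#
  1≉0 1≈0 = IsField.0≉1 isField (≈-sym 1≈0)

  ι≉0 : ι ≉ 0#
  ι≉0 = *-≉0ˡ {y = - ι} 1≉0

  1+ι≉0 : 1# + ι ≉ 0#
  1+ι≉0 = *-≉0ˡ {y = 1# - ι} 2≉0

  1-ι≉0 : 1# - ι ≉ 0#
  1-ι≉0 = *-≉0ˡ {y = 1# + ι} 2≉0

  -1+ι≉0 : - 1# + ι ≉ 0#
  -1+ι≉0 = *-≉0ˡ {y = - 1# - ι} 2≉0

  ρ : Fin 4 → SL
  ρ zero                   = mat 1# (1# + ι) (- 1# + ι) (- 1#) , ≈-refl
  ρ (suc zero)             = mat ι 0# 0# (- ι) , ≈-refl
  ρ (suc (suc zero))       = mat ι (- 1# + ι) 0# (- ι) , ≈-refl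
  ρ (suc (suc (suc zero))) = mat 0# (ζ * ζ * ζ) ζ 0# , ≈-refl

  trace-free≉±I : ∀ a b c (det≈1 : det F (mat a b c (- a)) ≈ 1#) → ¬ (mat a b c (- a) , det≈1) ≈± ε
  trace-free≉±I a b c det≈1 (same (a≈1 , _ , _ , -a≈1)) = 2≉0 (prove-from (a ∷ []) (Κ (+ 2)) (Κ 0ℤ)
    ((⊝ Κ 1ℤ , Ι (# 0) , Κ 1ℤ) ∷ (⊝ Κ 1ℤ , ⊝ Ι (# 0) , Κ 1ℤ) ∷ []) (a≈1 ∷ -a≈1 ∷ []) refl)
  trace-free≉±I a b c det≈1 (opposite (a≈-1 , _ , _ , -a≈-1)) = 2≉0 (prove-from (a ∷ []) (Κ (+ 2)) (Κ 0ℤ)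
    ((Κ 1ℤ , Ι (# 0) , ⊝ Κ 1ℤ) ∷ (Κ 1ℤ , ⊝ Ι (# 0) , ⊝ Κ 1ℤ) ∷ []) (a≈-1 ∷ -a≈-1 ∷ []) refl)

  involution : ∀ i → IsInvolution group (ρ i)
  involution zero                   = trace-free≉±I _ _ _ _ , opposite ≋-refl
  involution (suc zero)             = trace-free≉±I _ _ _ _ , opposite ≋-refl
  involution (suc (suc zero))       = trace-free≉±I _ _ _ _ , opposite ≋-refl
  involution (suc (suc (suc zero))) = trace-free≉±I _ _ _ _ , opposite ≋-refl

  separated-by : ∀ k {X Y} → entry k (proj₁ X) ≈ 0# → entry k (proj₁ Y) ≉ 0# → ¬ X ≈± Y
  separated-by k x≈0 y≉0 X≈±Y = y≉0 (≈±-preserves-zero k X≈±Y x≈0)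

  distinct : ∀ i j → i ≢ j → ¬ ρ i ≈± ρ j
  distinct zero                   zero                   i≢j = ⊥-elim (i≢j refl)
  distinct zero                   (suc zero)             _   = separated-by (# 1) ≈-refl 1+ι≉0 ∘ ≈±-sym
  distinct zero                   (suc (suc zero))       _   = separated-by (# 2) ≈-refl -1+ι≉0 ∘ ≈±-sym
  distinct zero                   (suc (suc (suc zero))) _   = separated-by (# 0) ≈-refl 1≉0 ∘ ≈±-sym
  distinct (suc zero)             zero                   _   = separated-by (# 1) ≈-refl 1+ι≉0
  distinct (suc zero)             (suc zero)             i≢j = ⊥-elim (i≢j refl)
  distinct (suc zero)             (suc (suc zero))       _   = separated-by (# 1) ≈-refl -1+ι≉0
  distinct (suc zero)             (suc (suc (suc zero))) _   = separated-by (# 0) ≈-refl ι≉0 ∘ ≈±-sym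
  distinct (suc (suc zero))       zero                   _   = separated-by (# 2) ≈-refl -1+ι≉0
  distinct (suc (suc zero))       (suc zero)             _   = separated-by (# 1) ≈-refl -1+ι≉0 ∘ ≈±-sym
  distinct (suc (suc zero))       (suc (suc zero))       i≢j = ⊥-elim (i≢j refl)
  distinct (suc (suc zero))       (suc (suc (suc zero))) _   = separated-by (# 0) ≈-refl ι≉0 ∘ ≈±-sym
  distinct (suc (suc (suc zero))) zero                   _   = separated-by (# 0) ≈-refl 1≉0
  distinct (suc (suc (suc zero))) (suc zero)             _   = separated-by (# 0) ≈-refl ι≉0
  distinct (suc (suc (suc zero))) (suc (suc zero))       _   = separated-by (# 0) ≈-refl ι≉0
  distinct (suc (suc (suc zero))) (suc (suc (suc zero))) i≢j = ⊥-elim (i≢j refl)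

  ⟨ρ₁,ρ₂,ρ₃⟩-generates : Generates group (ρ ∘ suc)
  ⟨ρ₁,ρ₂,ρ₃⟩-generates = generated-by-unitriangulars 1+ι≉0 1-ι≉0
    ((# 0 , false) ∷ (# 1 , false) ∷ [] , opposite ≋-refl)
    ((# 0 , false) ∷ (# 2 , false) ∷ (# 1 , false) ∷ (# 2 , false) ∷ [] , opposite ≋-refl)

  ⟨ρ₀,ρ₁,ρ₂⟩-generates : Generates group (ρ ∘ Fin.inject₁)
  ⟨ρ₀,ρ₁,ρ₂⟩-generates = generated-by-unitriangulars 1+ι≉0 -1+ι≉0
    ((# 1 , false) ∷ (# 2 , false) ∷ [] , opposite ≋-refl)
    ((# 0 , false) ∷ (# 2 , false) ∷ (# 1 , false) ∷ [] , opposite ≋-refl)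

  isStringRep : IsStringRep4 group ρ
  isStringRep = record
    { involutions = involution
    ; distinct    = distinct
    ; generating  = Generates-reindex ρ suc ⟨ρ₁,ρ₂,ρ₃⟩-generates
    ; comm02      = opposite ≋-refl
    ; comm03      = opposite ≋-refl
    ; comm13      = opposite ≋-refl
    }

  maniplex : Maniplex4 0ℓ 0ℓ
  maniplex = record { group = group ; ρ = ρ ; stringRep = isStringRep }

  class1 : Class1 maniplex
  class1 = ⟨ρ₁,ρ₂,ρ₃⟩-generates , ⟨ρ₀,ρ₁,ρ₂⟩-generates

  group≅PSL₂[p] : IsPSL₂OfPrimePower group
  group≅PSL₂[p] =
    F , p , p , 1 , prime , ℕP.≤-refl , sym (ℕP.*-identityʳ p) , isField , hasOrder , group≅PSL₂

  σ : SL
  σ = ρ (suc zero) ∙ ρ (suc (suc zero))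

  σ^n≈±U : ∀ n → σ ^ n ≈± U (n ×ₙ (1# + ι))
  σ^n≈±U n = ≈±-trans (^-cong n (opposite ≋-refl)) (U-^ (1# + ι) n)

  σ^p≈ε : σ ^ p ≈± ε
  σ^p≈ε = ≈±-trans (σ^n≈±U p) (≈±-trans (U-cong (p×ₙx≈0 (1# + ι))) (same ≋-refl))

  U≈±ε⇒≈0 : ∀ {t} → U t ≈± ε → t ≈ 0#
  U≈±ε⇒≈0 (same (_ , t≈0 , _ , _)) = t≈0
  U≈±ε⇒≈0 (opposite (1≈-1 , _))    = ⊥-elim (2≉0 (prove-from []
    (Κ (+ 2)) (Κ 0ℤ) ((Κ 1ℤ , Κ 1ℤ , ⊝ Κ 1ℤ) ∷ []) (1≈-1 ∷ []) refl))

  σ^n≈ε⇒p∣n : ∀ n → σ ^ n ≈± ε → p ℕ∣.∣ n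
  σ^n≈ε⇒p∣n n σ^n≈ε = n×ₙx≈0⇒p∣n n 1+ι≉0 (U≈±ε⇒≈0 (≈±-trans (≈±-sym (σ^n≈±U n)) σ^n≈ε))

non-isomorphic : ∀ P Q → CyclotomicPrime.p P ≢ CyclotomicPrime.p Q →
                 ¬ ManiplexIso (Maniplex.maniplex P) (Maniplex.maniplex Q)
non-isomorphic P Q p≢q (f , f-iso , f-ρ) =
  [ q≢1 , p≢q ∘ ≡.sym ]′ (prime⇒irreducible (CyclotomicPrime.prime P) q∣p)
  where
    open GroupMorphisms.IsGroupIsomorphism f-iso using (isMonoidHomomorphism; ∙-homo)
    open Group (Maniplex.group Q) using (∙-cong) renaming (trans to ≈-trans)

    q∣p : CyclotomicPrime.p Q ℕ∣.∣ CyclotomicPrime.p P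
    q∣p = Maniplex.σ^n≈ε⇒p∣n Q (CyclotomicPrime.p P)
            (^≈ε-transfer (Maniplex.group P) (Maniplex.group Q) isMonoidHomomorphism (CyclotomicPrime.p P)
              (≈-trans (∙-homo _ _) (∙-cong (f-ρ (# 1)) (f-ρ (# 2)))) (Maniplex.σ^p≈ε P))

    q≢1 : CyclotomicPrime.p Q ≢ 1
    q≢1 q≡1 = ¬prime[1] (subst Prime q≡1 (CyclotomicPrime.prime Q))

prime-divisor : ∀ n → 1 ℕ.< n → ∃[ q ] Prime q × q ℕ∣.∣ n
prime-divisor n 1<n = first-factor (PrimeFactorisation.factors f) (PrimeFactorisation.isFactorisation f)
                                   (PrimeFactorisation.factorsPrime f)
  where
    f : PrimeFactorisation n
    f = factorise n ⦃ ℕ.>-nonZero (ℕP.<-trans ℕP.0<1+n 1<n) ⦄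

    first-factor : ∀ qs → n ≡ product qs → All Prime qs → ∃[ q ] Prime q × q ℕ∣.∣ n
    first-factor []       n≡1       _             = contradiction n≡1 (ℕP.>⇒≢ 1<n)
    first-factor (q ∷ qs) n≡q*∏qs (q-prime ∷ _) =
      q , q-prime , divides (product qs) (trans n≡q*∏qs (ℕP.*-comm q (product qs)))

∣n! : ∀ {q n} .{{_ : ℕ.NonZero q}} → q ℕ.≤ n → q ℕ∣.∣ n ℕ.!
∣n! {ℕ.suc k} q≤n = ℕ∣.∣-trans (ℕ∣.m∣m*n (k ℕ.!)) (ℕ∣.m≤n⇒m!∣n! q≤n)

fourth-power : ℕ → ℕ
fourth-power N = N ℕ.* N ℕ.* N ℕ.* N

prime-divisor-of-factorial⁴+1 : ∀ n → ∃[ q ] Prime q × n ℕ.< q × q ℕ∣.∣ ℕ.suc (fourth-power (n ℕ.!))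
prime-divisor-of-factorial⁴+1 n =
  let q , q-prime , q∣N⁴+1 = prime-divisor (ℕ.suc (fourth-power N)) (ℕ.s≤s 1≤N⁴)
  in  q , q-prime , ℕP.≰⇒> (q≰n q-prime q∣N⁴+1) , q∣N⁴+1
  where
    N : ℕ
    N = n ℕ.!

    1≤N⁴ : 1 ℕ.≤ fourth-power N
    1≤N⁴ = ℕP.*-mono-≤ (ℕP.*-mono-≤ (ℕP.*-mono-≤ (ℕP.1≤n! n) (ℕP.1≤n! n)) (ℕP.1≤n! n)) (ℕP.1≤n! n)

    q≰n : ∀ {q} → Prime q → q ℕ∣.∣ ℕ.suc (fourth-power N) → ¬ q ℕ.≤ n
    q≰n {q} q-prime q∣N⁴+1 q≤n = ¬prime[1] (subst Prime (ℕ∣.∣1⇒≡1 q∣1) q-prime)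
      where
        q∣N : q ℕ∣.∣ N
        q∣N = ∣n! ⦃ prime⇒nonZero q-prime ⦄ q≤n

        q∣1 : q ℕ∣.∣ 1
        q∣1 = ℕ∣.∣m+n∣m⇒∣n (subst (q ℕ∣.∣_) (ℕP.+-comm 1 (fourth-power N)) q∣N⁴+1)
                           (ℕ∣.∣m⇒∣m*n N (ℕ∣.∣m⇒∣m*n N (ℕ∣.∣m⇒∣m*n N q∣N)))

pos-fourth-power+1 : ∀ N → + N ℤ.* + N ℤ.* + N ℤ.* + N ℤ.+ 1ℤ ≡ + ℕ.suc (fourth-power N)
pos-fourth-power+1 N = begin
  + N ℤ.* + N ℤ.* + N ℤ.* + N ℤ.+ 1ℤ   ≡⟨ cong (λ x → x ℤ.* + N ℤ.* + N ℤ.+ 1ℤ) (ℤP.pos-* N N) ⟨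
  + (N ℕ.* N) ℤ.* + N ℤ.* + N ℤ.+ 1ℤ   ≡⟨ cong (λ x → x ℤ.* + N ℤ.+ 1ℤ) (ℤP.pos-* (N ℕ.* N) N) ⟨
  + (N ℕ.* N ℕ.* N) ℤ.* + N ℤ.+ 1ℤ     ≡⟨ cong (ℤ._+ 1ℤ) (ℤP.pos-* (N ℕ.* N ℕ.* N) N) ⟨
  + (fourth-power N ℕ.+ 1)            ≡⟨ cong +_ (ℕP.+-comm (fourth-power N) 1) ⟩
  + ℕ.suc (fourth-power N)            ∎
  where open ≡-Reasoning

cyclotomicPrime-above : ∀ m → Σ CyclotomicPrime λ P → m ℕ.< CyclotomicPrime.p P
cyclotomicPrime-above m with prime-divisor-of-factorial⁴+1 (2 ℕ.+ m)
... | q , q-prime , 2+m<q , q∣N⁴+1 = P , ℕP.≤-<-trans (ℕP.m≤n+m m 2) 2+m<q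
  where
    P : CyclotomicPrime
    P = record
      { p      = q
      ; prime  = q-prime
      ; 2<p    = ℕP.≤-<-trans (ℕP.m≤m+n 2 m) 2+m<q
      ; N      = + ((2 ℕ.+ m) ℕ.!)
      ; p∣N⁴+1 = ∣ᵤ⇒∣ (subst (λ z → q ℕ∣.∣ ℤ.∣ z ∣) (sym (pos-fourth-power+1 ((2 ℕ.+ m) ℕ.!))) q∣N⁴+1)
      }

cyclotomicPrime : ℕ → CyclotomicPrime
cyclotomicPrime ℕ.zero    = proj₁ (cyclotomicPrime-above 0)
cyclotomicPrime (ℕ.suc k) = proj₁ (cyclotomicPrime-above (CyclotomicPrime.p (cyclotomicPrime k)))

p[_] : ℕ → ℕ
p[ k ] = CyclotomicPrime.p (cyclotomicPrime k)

p[]-monotone : ∀ {i j} → i ℕ.< j → p[ i ] ℕ.< p[ j ]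
p[]-monotone {i} {ℕ.suc j} i<1+j with ℕP.m≤n⇒m<n∨m≡n (ℕ.s≤s⁻¹ i<1+j)
... | inj₁ i<j  = ℕP.<-trans (p[]-monotone i<j) (proj₂ (cyclotomicPrime-above p[ j ]))
... | inj₂ refl = proj₂ (cyclotomicPrime-above p[ i ])

p[]-injective : ∀ {i j} → i ≢ j → p[ i ] ≢ p[ j ]
p[]-injective {i} {j} i≢j with ℕP.<-cmp i j
... | tri< i<j _ _ = ℕP.<⇒≢ (p[]-monotone i<j)
... | tri≈ _ i≡j _ = contradiction i≡j i≢j
... | tri> _ _ j<i = ℕP.>⇒≢ (p[]-monotone j<i)

mainTheorem9 : Σ (ℕ → Maniplex4 0ℓ 0ℓ) λ M →
    (∀ n → IsPSL₂OfPrimePower (Maniplex4.group (M n)) × Class1 (M n))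
    × (∀ i j → i ≢ j → ¬ ManiplexIso (M i) (M j))
mainTheorem9 =
    Maniplex.maniplex ∘ cyclotomicPrime
  , (λ n → Maniplex.group≅PSL₂[p] (cyclotomicPrime n) , Maniplex.class1 (cyclotomicPrime n))
  , λ i j i≢j → non-isomorphic (cyclotomicPrime i) (cyclotomicPrime j) (p[]-injective i≢j)
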